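{- For every integer $n\geq2$, \[ CP_{(2,2)}(n)=\frac{1+q^{2n-2}+q^{2n-1}}{(1-q^{2n-1})(1-q^{2n})}CP_{(2,2)}(n-1)+\frac{q^{2n-2}(1-q^{2n-3})}{(1-q^{2n-3})(1-q^{2n-2})(1-q^{2n-1})(1-q^{2n})}CP_{(2,2)}(n-2). \]
   Context: A cylindric partition with profile $(c_1,c_2)$ is a pair of partitions $(\lambda^{(1)},\lambda^{(2)})$ (parts weakly decreasing, $\lambda^{(i)}_j=0$ beyond the number of parts) with $\lambda^{(1)}_j\ge\lambda^{(2)}_{j+c_2}$ and $\lambda^{(2)}_j\ge\lambda^{(1)}_{j+c_1}$ for all $j\ge1$; its size is $|\lambda^{(1)}|+|\lambda^{(2)}|$. $CP_{(2,2)}(n)$ is the generating function $\sum q^{\text{size}}$ over cylindric partitions of profile $(2,2)$ in which each partition has at most $n$ parts, with $CP_{(2,2)}(0)=1$. -}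

module Defs where

open import Data.Nat as ℕ using (ℕ; zero; suc; _∸_; _≤_; _≤?_)
import Data.Nat.Divisibility as Div
open import Data.Integer as ℤ using (ℤ; +_; _-_)
open import Data.List using (List; []; _∷_; map; concatMap; upTo; filter; length; cartesianProduct; foldr)
import Data.List as List
open import Data.List.Relation.Unary.All using (All; all?)
open import Data.Product using (_×_; _,_; proj₁; proj₂)
open import Relation.Nullary using (Dec; yes; no)
open import Relation.Nullary.Decidable using (_×-dec_)
open import Relation.Binary.PropositionalEquality using (_≡_)

-- Partitions with at most n parts, represented as lists of length n
-- (padded by zeros).  Parts are indexed from 0 here: part i (0-based)
-- is the paper's part λ_{i+1}; beyond the list the part is 0.

nth : List ℕ → ℕ → ℕ
nth []       _       = 0
nth (x ∷ _)  zero    = x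
nth (_ ∷ xs) (suc i) = nth xs i

vecs : ℕ → ℕ → List (List ℕ)
vecs zero    k = [] ∷ []
vecs (suc n) k = concatMap (λ x → map (x ∷_) (vecs n k)) (upTo (suc k))

-- weakly decreasing parts (for a list of length n, checking i < n suffices,
-- since all parts at positions ≥ n are 0)
IsPartition : ℕ → List ℕ → Set
IsPartition n l = All (λ i → nth l (suc i) ≤ nth l i) (upTo n)

isPartition? : ∀ n l → Dec (IsPartition n l)
isPartition? n l = all? (λ i → nth l (suc i) ≤? nth l i) (upTo n)

-- cylindric conditions for profile (2,2):
--   λ¹_j ≥ λ²_{j+2} and λ²_j ≥ λ¹_{j+2} for all j ≥ 1
-- (for j > n both sides are 0, so checking j ≤ n suffices)
IsCyl22 : ℕ → List ℕ → List ℕ → Set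
IsCyl22 n l1 l2 =
  All (λ i → nth l2 (i ℕ.+ 2) ≤ nth l1 i) (upTo n) ×
  All (λ i → nth l1 (i ℕ.+ 2) ≤ nth l2 i) (upTo n)

size : List ℕ → ℕ
size = foldr ℕ._+_ 0

IsCP22 : ℕ → ℕ → List ℕ × List ℕ → Set
IsCP22 n k (l1 , l2) =
  IsPartition n l1 × IsPartition n l2 × IsCyl22 n l1 l2 × (size l1 ℕ.+ size l2 ≡ k)

isCP22? : ∀ n k p → Dec (IsCP22 n k p)
isCP22? n k (l1 , l2) =
  isPartition? n l1 ×-dec isPartition? n l2 ×-dec
  ((all? (λ i → nth l2 (i ℕ.+ 2) ≤? nth l1 i) (upTo n) ×-dec
    all? (λ i → nth l1 (i ℕ.+ 2) ≤? nth l2 i) (upTo n)) ×-dec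
   (size l1 ℕ.+ size l2 ℕ.≟ k))

-- Formal power series in q with integer coefficients: coefficient maps.

Series : Set
Series = ℕ → ℤ

sumℤ : List ℤ → ℤ
sumℤ = foldr ℤ._+_ (+ 0)

infixl 6 _⊕_ _⊖_
infixl 7 _⊛_

_⊕_ : Series → Series → Series
(f ⊕ g) k = f k ℤ.+ g k

_⊖_ : Series → Series → Series
(f ⊖ g) k = f k - g k

_⊛_ : Series → Series → Series
(f ⊛ g) k = sumℤ (map (λ i → f i ℤ.* g (k ∸ i)) (upTo (suc k)))

one : Series
one zero    = + 1
one (suc _) = + 0

qpow : ℕ → Series
qpow m k with m ℕ.≟ k
... | yes _ = + 1
... | no  _ = + 0

-- 1/(1 - q^e) = Σ_{j≥0} q^{e j}, meaningful for e ≥ 1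
inv1mq : ℕ → Series
inv1mq e k with e Div.∣? k
... | yes _ = + 1
... | no  _ = + 0

CP22 : ℕ → Series
CP22 n k = + length (filter (isCP22? n k) (cartesianProduct (vecs n k) (vecs n k)))

-- Let CP≤≤ α β be the generating function of the cylindric partitions of profile (2,2)
-- with at most n parts in which λ¹ has at most α and λ² at most β nonzero parts, CP≤≡ α β
-- the part of it where λ² has exactly β parts, and CP≡≡ α β the part where moreover λ¹
-- has exactly α parts. Splitting off the pairs with an extra part gives
-- CP≤≤ α (β+1) = CP≤≤ α β + CP≤≡ α (β+1) and CP≤≡ (α+1) β = CP≡≡ (α+1) β + CP≤≡ α β;
-- since λ¹ᵢ ≥ λ²ᵢ₊₂, CP≤≡ α (α+2) = CP≡≡ α (α+2); swapping λ¹ and λ² gives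
-- CP≤≤ α β = CP≤≤ β α; and removing the first column of both Young diagrams, which
-- preserves the interlacing when |α − β| ≤ 2, gives CP≡≡ α β = q^(α+β) CP≤≤ α β.
-- For α, β ∈ {n−2, n−1, n} these relations form a linear system over the ring of integer
-- power series, in which 1 − q^e is invertible for e > 0; eliminating the auxiliary
-- series gives the recurrence.
module Submission where

open import Defs

module PowerSeries where

  open import Data.Nat as ℕ using (ℕ; zero; suc; _∸_; _<_; s≤s)
  import Data.Nat.Properties as ℕP
  import Data.Nat.Divisibility as ℕ∣
  open import Data.Integer as ℤ using (ℤ; +_; -[1+_]; 0ℤ; 1ℤ; _+_; _*_; -_)
  import Data.Integer.Properties as ℤP
  open import Data.Integer.Tactic.RingSolver using (solve-∀)
  open import Data.Fin using (Fin; toℕ; opposite)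
  import Data.Fin.Properties as FinP
  import Data.Fin.Permutation as Perm
  open import Data.List using (applyUpTo)
  import Data.List.Properties as LP
  open import Data.Maybe using (Maybe; just; nothing)
  open import Data.Product using (_,_)
  open import Function using (_∘_; id)
  open import Level using (0ℓ)
  open import Relation.Nullary using (yes; no; contradiction)
  open import Relation.Binary.PropositionalEquality
  open import Algebra.Bundles using (CommutativeRing)
  open import Algebra.Structures using (IsCommutativeRing)
  open import Algebra.Properties.Semiring.Sum ℤP.+-*-semiring
    using (sum; sum-syntax; sum-cong-≗; *-distribˡ-sum; sum-replicate-zero; ∑-distrib-+; sum-permute)
  import Algebra.Solver.Ring.AlmostCommutativeRing as ACR
  import Algebra.Solver.Ring

  sumℤ-applyUpTo : ∀ n (h : ℕ → ℤ) → sumℤ (applyUpTo h n) ≡ ∑[ i < n ] h (toℕ i)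
  sumℤ-applyUpTo zero    h = refl
  sumℤ-applyUpTo (suc n) h = cong (_+_ (h 0)) (sumℤ-applyUpTo n (h ∘ suc))

  ⊛-terms : Series → Series → (k : ℕ) → Fin (suc k) → ℤ
  ⊛-terms f g k i = f (toℕ i) * g (k ∸ toℕ i)

  ⊛-coeff : ∀ f g k → (f ⊛ g) k ≡ sum (⊛-terms f g k)
  ⊛-coeff f g k = trans (cong sumℤ (LP.map-applyUpTo id (λ i → f i * g (k ∸ i)) (suc k)))
                        (sumℤ-applyUpTo (suc k) (λ i → f i * g (k ∸ i)))

  ⊛-coeff-zero : ∀ f g → (f ⊛ g) 0 ≡ f 0 * g 0
  ⊛-coeff-zero f g = ℤP.+-identityʳ (f 0 * g 0)

  ⊛-coeff-suc : ∀ f g k → (f ⊛ g) (suc k) ≡ f 0 * g (suc k) + (f ∘ suc ⊛ g) k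
  ⊛-coeff-suc f g k =
    trans (⊛-coeff f g (suc k)) (cong (_+_ (f 0 * g (suc k))) (sym (⊛-coeff (f ∘ suc) g k)))

  -- A record rather than pointwise equality _≗_, so that both series can be
  -- inferred from a proof of their equality.
  infix 4 _≈_
  record _≈_ (f g : Series) : Set where
    constructor pointwise
    field at : ∀ k → f k ≡ g k
  open _≈_ public

  ≈-refl : ∀ {f} → f ≈ f
  ≈-refl = pointwise λ _ → refl

  ≡⇒≈ : ∀ {f g} → f ≡ g → f ≈ g
  ≡⇒≈ refl = ≈-refl

  zeroˢ : Series
  zeroˢ _ = 0ℤ

  neg : Series → Series
  neg f k = - f k

  scale : ℤ → Series → Series
  scale c f k = c * f k

  ⊕-cong : ∀ {f f′ g g′} → f ≈ f′ → g ≈ g′ → f ⊕ g ≈ f′ ⊕ g′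
  ⊕-cong f≈f′ g≈g′ = pointwise λ k → cong₂ _+_ (at f≈f′ k) (at g≈g′ k)

  ⊛-cong : ∀ {f f′ g g′} → f ≈ f′ → g ≈ g′ → f ⊛ g ≈ f′ ⊛ g′
  ⊛-cong {f} {f′} {g} {g′} f≈f′ g≈g′ = pointwise λ k → begin
    (f ⊛ g) k
      ≡⟨ ⊛-coeff f g k ⟩
    sum (⊛-terms f g k)
      ≡⟨ sum-cong-≗ {suc k} (λ i → cong₂ _*_ (at f≈f′ (toℕ i)) (at g≈g′ (k ∸ toℕ i))) ⟩
    sum (⊛-terms f′ g′ k)
      ≡⟨ ⊛-coeff f′ g′ k ⟨
    (f′ ⊛ g′) k ∎
    where open ≡-Reasoning

  ⊛-comm : ∀ f g → f ⊛ g ≈ g ⊛ f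
  ⊛-comm f g = pointwise λ k → begin
    (f ⊛ g) k                       ≡⟨ ⊛-coeff f g k ⟩
    sum (⊛-terms f g k)             ≡⟨ sum-permute (⊛-terms f g k) Perm.reverse ⟩
    sum (⊛-terms f g k ∘ opposite)  ≡⟨ sum-cong-≗ {suc k} (reflect k) ⟩
    sum (⊛-terms g f k)             ≡⟨ ⊛-coeff g f k ⟨
    (g ⊛ f) k                       ∎
    where
    open ≡-Reasoning
    reflect : ∀ k (i : Fin (suc k)) → ⊛-terms f g k (opposite i) ≡ ⊛-terms g f k i
    reflect k i rewrite FinP.opposite-prop i | ℕP.m∸[m∸n]≡n (ℕP.≤-pred (FinP.toℕ<n i)) =
      ℤP.*-comm (f (k ∸ toℕ i)) (g (toℕ i))

  ⊛-distribʳ : ∀ h f g → (f ⊕ g) ⊛ h ≈ f ⊛ h ⊕ g ⊛ h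
  ⊛-distribʳ h f g = pointwise λ k → begin
    ((f ⊕ g) ⊛ h) k
      ≡⟨ ⊛-coeff (f ⊕ g) h k ⟩
    sum (⊛-terms (f ⊕ g) h k)
      ≡⟨ sum-cong-≗ {suc k} (λ i → ℤP.*-distribʳ-+ (h (k ∸ toℕ i)) (f (toℕ i)) (g (toℕ i))) ⟩
    sum (λ i → ⊛-terms f h k i + ⊛-terms g h k i)
      ≡⟨ ∑-distrib-+ (⊛-terms f h k) (⊛-terms g h k) ⟩
    sum (⊛-terms f h k) + sum (⊛-terms g h k)
      ≡⟨ cong₂ _+_ (⊛-coeff f h k) (⊛-coeff g h k) ⟨
    (f ⊛ h ⊕ g ⊛ h) k ∎
    where open ≡-Reasoning

  ⊛-scaleˡ : ∀ c f g → scale c f ⊛ g ≈ scale c (f ⊛ g)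
  ⊛-scaleˡ c f g = pointwise λ k → begin
    (scale c f ⊛ g) k
      ≡⟨ ⊛-coeff (scale c f) g k ⟩
    sum (⊛-terms (scale c f) g k)
      ≡⟨ sum-cong-≗ {suc k} (λ i → ℤP.*-assoc c (f (toℕ i)) (g (k ∸ toℕ i))) ⟩
    sum (λ i → c * ⊛-terms f g k i)
      ≡⟨ *-distribˡ-sum c (⊛-terms f g k) ⟨
    c * sum (⊛-terms f g k)
      ≡⟨ cong (c *_) (⊛-coeff f g k) ⟨
    scale c (f ⊛ g) k ∎
    where open ≡-Reasoning

  ⊛-zeroˡ : ∀ f → zeroˢ ⊛ f ≈ zeroˢ
  ⊛-zeroˡ f = pointwise λ k → begin
    (zeroˢ ⊛ f) k            ≡⟨ ⊛-coeff zeroˢ f k ⟩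
    sum (⊛-terms zeroˢ f k)  ≡⟨ sum-replicate-zero (suc k) ⟩
    0ℤ                       ∎
    where open ≡-Reasoning

  ⊛-assoc : ∀ f g h → (f ⊛ g) ⊛ h ≈ f ⊛ (g ⊛ h)
  ⊛-assoc f g h = pointwise (go f)
    where
    open ≡-Reasoning
    regroup : ∀ a b c d e → a * b * c + (a * d + e) ≡ a * (b * c + d) + e
    regroup = solve-∀
    go : ∀ f k → ((f ⊛ g) ⊛ h) k ≡ (f ⊛ (g ⊛ h)) k
    go f zero = begin
      ((f ⊛ g) ⊛ h) 0    ≡⟨ ⊛-coeff-zero (f ⊛ g) h ⟩
      (f ⊛ g) 0 * h 0    ≡⟨ cong (_* h 0) (⊛-coeff-zero f g) ⟩
      f 0 * g 0 * h 0    ≡⟨ ℤP.*-assoc (f 0) (g 0) (h 0) ⟩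
      f 0 * (g 0 * h 0)  ≡⟨ cong (f 0 *_) (⊛-coeff-zero g h) ⟨
      f 0 * (g ⊛ h) 0    ≡⟨ ⊛-coeff-zero f (g ⊛ h) ⟨
      (f ⊛ (g ⊛ h)) 0    ∎
    go f (suc k) = begin
      ((f ⊛ g) ⊛ h) (suc k)
        ≡⟨ ⊛-coeff-suc (f ⊛ g) h k ⟩
      (f ⊛ g) 0 * h (suc k) + ((f ⊛ g) ∘ suc ⊛ h) k
        ≡⟨ cong₂ _+_ (cong (_* h (suc k)) (⊛-coeff-zero f g)) (at (⊛-cong tail (≈-refl {h})) k) ⟩
      f 0 * g 0 * h (suc k) + ((scale (f 0) (g ∘ suc) ⊕ f ∘ suc ⊛ g) ⊛ h) k
        ≡⟨ cong (_+_ (f 0 * g 0 * h (suc k))) (at (⊛-distribʳ h (scale (f 0) (g ∘ suc)) (f ∘ suc ⊛ g)) k) ⟩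
      f 0 * g 0 * h (suc k) + ((scale (f 0) (g ∘ suc) ⊛ h) k + ((f ∘ suc ⊛ g) ⊛ h) k)
        ≡⟨ cong (_+_ (f 0 * g 0 * h (suc k))) (cong₂ _+_ (at (⊛-scaleˡ (f 0) (g ∘ suc) h) k) (go (f ∘ suc) k)) ⟩
      f 0 * g 0 * h (suc k) + (f 0 * (g ∘ suc ⊛ h) k + (f ∘ suc ⊛ (g ⊛ h)) k)
        ≡⟨ regroup (f 0) (g 0) (h (suc k)) _ _ ⟩
      f 0 * (g 0 * h (suc k) + (g ∘ suc ⊛ h) k) + (f ∘ suc ⊛ (g ⊛ h)) k
        ≡⟨ cong (λ c → f 0 * c + (f ∘ suc ⊛ (g ⊛ h)) k) (⊛-coeff-suc g h k) ⟨
      f 0 * (g ⊛ h) (suc k) + (f ∘ suc ⊛ (g ⊛ h)) k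
        ≡⟨ ⊛-coeff-suc f (g ⊛ h) k ⟨
      (f ⊛ (g ⊛ h)) (suc k) ∎
      where
      tail : (f ⊛ g) ∘ suc ≈ scale (f 0) (g ∘ suc) ⊕ f ∘ suc ⊛ g
      tail = pointwise (⊛-coeff-suc f g)

  shift : ℕ → Series → Series
  shift zero    f k       = f k
  shift (suc m) f zero    = 0ℤ
  shift (suc m) f (suc k) = shift m f k

  shift-+ : ∀ m f j → shift m f (m ℕ.+ j) ≡ f j
  shift-+ zero    f j = refl
  shift-+ (suc m) f j = shift-+ m f j

  shift-< : ∀ {m k} f → k < m → shift m f k ≡ 0ℤ
  shift-< {suc m} {zero}  f _         = refl
  shift-< {suc m} {suc k} f (s≤s k<m) = shift-< f k<m

  qpow-suc : ∀ m k → qpow (suc m) (suc k) ≡ qpow m k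
  qpow-suc m k with m ℕ.≟ k | suc m ℕ.≟ suc k
  ... | yes _   | yes _   = refl
  ... | no  _   | no  _   = refl
  ... | yes m≡k | no  m≢k = contradiction (cong suc m≡k) m≢k
  ... | no  m≢k | yes m≡k = contradiction (ℕP.suc-injective m≡k) m≢k

  qpow-⊛ : ∀ m f → qpow m ⊛ f ≈ shift m f
  qpow-⊛ m f = pointwise (go m)
    where
    open ≡-Reasoning
    go : ∀ m k → (qpow m ⊛ f) k ≡ shift m f k
    go zero    zero    = trans (⊛-coeff-zero (qpow 0) f) (ℤP.*-identityˡ (f 0))
    go zero    (suc k) = begin
      (qpow 0 ⊛ f) (suc k)                         ≡⟨ ⊛-coeff-suc (qpow 0) f k ⟩
      1ℤ * f (suc k) + (zeroˢ ⊛ f) k               ≡⟨ cong₂ _+_ (ℤP.*-identityˡ (f (suc k))) (at (⊛-zeroˡ f) k) ⟩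
      f (suc k) + 0ℤ                               ≡⟨ ℤP.+-identityʳ (f (suc k)) ⟩
      f (suc k)                                    ∎
    go (suc m) zero    = ⊛-coeff-zero (qpow (suc m)) f
    go (suc m) (suc k) = begin
      (qpow (suc m) ⊛ f) (suc k)                   ≡⟨ ⊛-coeff-suc (qpow (suc m)) f k ⟩
      0ℤ * f (suc k) + (qpow (suc m) ∘ suc ⊛ f) k  ≡⟨ ℤP.+-identityˡ _ ⟩
      (qpow (suc m) ∘ suc ⊛ f) k                   ≡⟨ at (⊛-cong (pointwise (qpow-suc m)) (≈-refl {f})) k ⟩
      (qpow m ⊛ f) k                               ≡⟨ go m k ⟩
      shift m f k                                  ∎

  ⊛-identityˡ : ∀ f → one ⊛ f ≈ f
  ⊛-identityˡ f = pointwise λ k → trans (at (⊛-cong one≈qpow0 (≈-refl {f})) k) (at (qpow-⊛ 0 f) k)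
    where
    one≈qpow0 : one ≈ qpow 0
    one≈qpow0 = pointwise λ { zero → refl ; (suc k) → refl }

  series-isCommutativeRing : IsCommutativeRing _≈_ _⊕_ _⊛_ neg zeroˢ one
  series-isCommutativeRing = record
    { isRing = record
      { +-isAbelianGroup = record
        { isGroup = record
          { isMonoid = record
            { isSemigroup = record
              { isMagma = record
                { isEquivalence = record
                  { refl  = ≈-refl
                  ; sym   = λ f≈g → pointwise λ k → sym (at f≈g k)
                  ; trans = λ f≈g g≈h → pointwise λ k → trans (at f≈g k) (at g≈h k)
                  }
                ; ∙-cong = ⊕-cong
                }
              ; assoc = λ f g h → pointwise λ k → ℤP.+-assoc (f k) (g k) (h k)
              }
            ; identity = (λ f → pointwise λ k → ℤP.+-identityˡ (f k))
                       , (λ f → pointwise λ k → ℤP.+-identityʳ (f k))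
            }
          ; inverse = (λ f → pointwise λ k → ℤP.+-inverseˡ (f k))
                    , (λ f → pointwise λ k → ℤP.+-inverseʳ (f k))
          ; ⁻¹-cong = λ f≈g → pointwise λ k → cong -_ (at f≈g k)
          }
        ; comm = λ f g → pointwise λ k → ℤP.+-comm (f k) (g k)
        }
      ; *-cong     = ⊛-cong
      ; *-assoc    = ⊛-assoc
      ; *-identity = ⊛-identityˡ
                   , λ f → pointwise λ k → trans (at (⊛-comm f one) k) (at (⊛-identityˡ f) k)
      ; distrib    = (λ h f g → pointwise λ k → trans (at (⊛-comm h (f ⊕ g)) k)
                                             (trans (at (⊛-distribʳ h f g) k)
                                                    (cong₂ _+_ (at (⊛-comm f h) k) (at (⊛-comm g h) k))))
                   , ⊛-distribʳ
      }
    ; *-comm = ⊛-comm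
    }

  seriesRing : CommutativeRing 0ℓ 0ℓ
  seriesRing = record { isCommutativeRing = series-isCommutativeRing }

  -- `constant 1ℤ` is definitionally `one`, so that the solver's `con 1ℤ` is the unit
  -- occurring in goals.
  constant : ℤ → Series
  constant (+ 1) = one
  constant c     = scale c one

  constant-scale : ∀ c → constant c ≈ scale c one
  constant-scale (+ 1)           = pointwise λ k → sym (ℤP.*-identityˡ (one k))
  constant-scale (+ 0)           = ≈-refl
  constant-scale (+ suc (suc n)) = ≈-refl
  constant-scale -[1+ n ]        = ≈-refl

  constant-homomorphism : CommutativeRing.rawRing ℤP.+-*-commutativeRing
                            ACR.-Raw-AlmostCommutative⟶ ACR.fromCommutativeRing seriesRing
  constant-homomorphism = record
    { ⟦_⟧    = constant
    ; +-homo = λ c d → pointwise λ k → begin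
        constant (c + d) k             ≡⟨ at (constant-scale (c + d)) k ⟩
        (c + d) * one k                ≡⟨ ℤP.*-distribʳ-+ (one k) c d ⟩
        c * one k + d * one k          ≡⟨ cong₂ _+_ (at (constant-scale c) k) (at (constant-scale d) k) ⟨
        constant c k + constant d k    ∎
    ; *-homo = λ c d → pointwise λ k → begin
        constant (c * d) k             ≡⟨ at (constant-scale (c * d)) k ⟩
        c * d * one k                  ≡⟨ ℤP.*-assoc c d (one k) ⟩
        c * (d * one k)                ≡⟨ cong (c *_) (at (⊛-identityˡ (scale d one)) k) ⟨
        c * (one ⊛ scale d one) k      ≡⟨ at (⊛-scaleˡ c one (scale d one)) k ⟨
        (scale c one ⊛ scale d one) k  ≡⟨ at (⊛-cong (constant-scale c) (constant-scale d)) k ⟨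
        (constant c ⊛ constant d) k    ∎
    ; -‿homo = λ c → pointwise λ k → begin
        constant (- c) k               ≡⟨ at (constant-scale (- c)) k ⟩
        - c * one k                    ≡⟨ ℤP.neg-distribˡ-* c (one k) ⟨
        - (c * one k)                  ≡⟨ cong -_ (at (constant-scale c) k) ⟨
        - constant c k                 ∎
    ; 0-homo = pointwise λ k → ℤP.*-zeroˡ (one k)
    ; 1-homo = ≈-refl
    }
    where open ≡-Reasoning

  constant-≟ : ∀ c d → Maybe (constant c ≈ constant d)
  constant-≟ c d with c ℤ.≟ d
  ... | yes refl = just ≈-refl
  ... | no  _    = nothing

  open Algebra.Solver.Ring _ _ constant-homomorphism constant-≟
    public using (Polynomial; solve; _:=_; _:+_; _:*_; _:-_; con)

  :1 : ∀ {n} → Polynomial n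
  :1 = con 1ℤ

  inv1mq-unfold : ∀ e → inv1mq (suc e) ≈ one ⊕ shift (suc e) (inv1mq (suc e))
  inv1mq-unfold e = pointwise go
    where
    I : Series
    I = inv1mq (suc e)
    go : ∀ k → I k ≡ one k + shift (suc e) I k
    go k with k ℕ.<? suc e
    go zero    | yes _ with suc e ℕ∣.∣? 0
    ... | yes _   = refl
    ... | no  e∤0 = contradiction (ℕ∣._∣0 (suc e)) e∤0
    go (suc k) | yes k<e with suc e ℕ∣.∣? suc k
    ... | yes e∣k = contradiction (ℕ∣.∣⇒≤ e∣k) (ℕP.<⇒≱ k<e)
    ... | no  _   = sym (cong (_+_ 0ℤ) (shift-< I k<e))
    go k | no e≮k with j , refl ← ℕP.m≤n⇒∃[o]m+o≡n (ℕP.≮⇒≥ e≮k) = begin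
      I (suc e ℕ.+ j)                       ≡⟨ periodic ⟩
      I j                                   ≡⟨ shift-+ (suc e) I j ⟨
      shift (suc e) I (suc e ℕ.+ j)         ≡⟨ ℤP.+-identityˡ _ ⟨
      0ℤ + shift (suc e) I (suc e ℕ.+ j)    ∎
      where
      open ≡-Reasoning
      periodic : I (suc e ℕ.+ j) ≡ I j
      periodic with suc e ℕ∣.∣? suc e ℕ.+ j | suc e ℕ∣.∣? j
      ... | yes _ | yes _ = refl
      ... | no  _ | no  _ = refl
      ... | yes d | no ¬d = contradiction (ℕ∣.∣m+n∣m⇒∣n d ℕ∣.∣-refl) ¬d
      ... | no ¬d | yes d = contradiction (ℕ∣.∣m∣n⇒∣m+n ℕ∣.∣-refl d) ¬d

module RecurrenceAlgebra where

  open import Data.Nat using (suc; _<_)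
  open import Algebra.Bundles using (CommutativeRing)
  open PowerSeries using (seriesRing; solve; _:=_; _:+_; _:*_; _:-_; :1; shift; qpow-⊛; inv1mq-unfold)
  open CommutativeRing seriesRing
  open import Relation.Binary.Reasoning.Setoid setoid

  x≈a+tx⇒[1-t]x≈a : ∀ {x a t} → x ≈ a + t * x → (1# - t) * x ≈ a
  x≈a+tx⇒[1-t]x≈a {x} {a} {t} x≈a+tx = begin
    (1# - t) * x       ≈⟨ solve 2 (λ x t → (:1 :- t) :* x := x :- t :* x) refl x t ⟩
    x - t * x          ≈⟨ +-congʳ x≈a+tx ⟩
    a + t * x - t * x  ≈⟨ solve 3 (λ a t x → a :+ t :* x :- t :* x := a) refl a t x ⟩
    a                  ∎

  record Recurrences (c₀ c₁ c₂ u v w : Carrier) : Set where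
    field
      x y z b : Carrier
      eq₀ : c₀ ≈ x + (w * c₀ + (v * x + u * y))
      eq₁ : x ≈ c₁ + (v * x + u * y)
      eq₂ : y ≈ z + u * y
      eq₃ : c₁ ≈ z + (u * c₁ + b)
      eq₄ : z ≈ c₂ + b

  module _ {c₀ c₁ c₂ u v w} (eqs : Recurrences c₀ c₁ c₂ u v w) where

    open Recurrences eqs

    reduced-c₀ : (1# - w) * c₀ ≈ (1# + v) * x + u * y
    reduced-c₀ = x≈a+tx⇒[1-t]x≈a {c₀} {(1# + v) * x + u * y} {w} (trans eq₀
      (solve 6 (λ x w c₀ v u y → x :+ (w :* c₀ :+ (v :* x :+ u :* y)) := (:1 :+ v) :* x :+ u :* y :+ w :* c₀)
               refl x w c₀ v u y))

    reduced-x : (1# - v) * x ≈ c₁ + u * y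
    reduced-x = x≈a+tx⇒[1-t]x≈a {x} {c₁ + u * y} {v} (trans eq₁
      (solve 5 (λ c₁ v x u y → c₁ :+ (v :* x :+ u :* y) := c₁ :+ u :* y :+ v :* x) refl c₁ v x u y))

    reduced-y : (1# - u) * y ≈ z
    reduced-y = x≈a+tx⇒[1-t]x≈a {y} {z} {u} eq₂

    reduced-c₁ : (1# - u) * c₁ + c₂ ≈ z + z
    reduced-c₁ = begin
      (1# - u) * c₁ + c₂  ≈⟨ +-congʳ {c₂} (x≈a+tx⇒[1-t]x≈a {c₁} {z + b} {u} (trans eq₃
                               (solve 4 (λ z u c₁ b → z :+ (u :* c₁ :+ b) := z :+ b :+ u :* c₁) refl z u c₁ b))) ⟩
      z + b + c₂          ≈⟨ solve 3 (λ z b c₂ → z :+ b :+ c₂ := z :+ (c₂ :+ b)) refl z b c₂ ⟩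
      z + (c₂ + b)        ≈⟨ +-congˡ {z} eq₄ ⟨
      z + z               ∎

    x-eliminated : (1# - v) * (1# - w) * c₀ ≈ (1# + v) * c₁ + u * (y + y)
    x-eliminated = begin
      (1# - v) * (1# - w) * c₀
        ≈⟨ *-assoc (1# - v) (1# - w) c₀ ⟩
      (1# - v) * ((1# - w) * c₀)
        ≈⟨ *-congˡ {1# - v} reduced-c₀ ⟩
      (1# - v) * ((1# + v) * x + u * y)
        ≈⟨ solve 4 (λ v x u y → (:1 :- v) :* ((:1 :+ v) :* x :+ u :* y)
                             := (:1 :+ v) :* ((:1 :- v) :* x) :+ (:1 :- v) :* u :* y) refl v x u y ⟩
      (1# + v) * ((1# - v) * x) + (1# - v) * u * y
        ≈⟨ +-congʳ {(1# - v) * u * y} (*-congˡ {1# + v} reduced-x) ⟩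
      (1# + v) * (c₁ + u * y) + (1# - v) * u * y
        ≈⟨ solve 4 (λ v c₁ u y → (:1 :+ v) :* (c₁ :+ u :* y) :+ (:1 :- v) :* u :* y
                              := (:1 :+ v) :* c₁ :+ u :* (y :+ y)) refl v c₁ u y ⟩
      (1# + v) * c₁ + u * (y + y) ∎

    cleared-recurrence : (1# - u) * (1# - v) * (1# - w) * c₀ ≈ (1# - u) * (1# + u + v) * c₁ + u * c₂
    cleared-recurrence = begin
      (1# - u) * (1# - v) * (1# - w) * c₀
        ≈⟨ solve 4 (λ u v w c₀ → (:1 :- u) :* (:1 :- v) :* (:1 :- w) :* c₀
                              := (:1 :- u) :* ((:1 :- v) :* (:1 :- w) :* c₀)) refl u v w c₀ ⟩
      (1# - u) * ((1# - v) * (1# - w) * c₀)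
        ≈⟨ *-congˡ {1# - u} x-eliminated ⟩
      (1# - u) * ((1# + v) * c₁ + u * (y + y))
        ≈⟨ solve 4 (λ u v c₁ y → (:1 :- u) :* ((:1 :+ v) :* c₁ :+ u :* (y :+ y))
                              := (:1 :- u) :* (:1 :+ v) :* c₁ :+ u :* ((:1 :- u) :* y :+ (:1 :- u) :* y))
                   refl u v c₁ y ⟩
      (1# - u) * (1# + v) * c₁ + u * ((1# - u) * y + (1# - u) * y)
        ≈⟨ +-congˡ {(1# - u) * (1# + v) * c₁} (*-congˡ {u} (+-cong reduced-y reduced-y)) ⟩
      (1# - u) * (1# + v) * c₁ + u * (z + z)
        ≈⟨ +-congˡ {(1# - u) * (1# + v) * c₁} (*-congˡ {u} reduced-c₁) ⟨
      (1# - u) * (1# + v) * c₁ + u * ((1# - u) * c₁ + c₂)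
        ≈⟨ solve 4 (λ u v c₁ c₂ → (:1 :- u) :* (:1 :+ v) :* c₁ :+ u :* ((:1 :- u) :* c₁ :+ c₂)
                               := (:1 :- u) :* (:1 :+ u :+ v) :* c₁ :+ u :* c₂) refl u v c₁ c₂ ⟩
      (1# - u) * (1# + u + v) * c₁ + u * c₂ ∎

  record OneMinusInverse (x i : Carrier) : Set where
    field inverse : i * (1# - x) ≈ 1#
  open OneMinusInverse

  -- t enters only through the factor (1 − t) t⁻ = 1 that the statement keeps in its second term.
  recurrence : ∀ {c₀ c₁ c₂ u v w t t⁻ u⁻ v⁻ w⁻} → Recurrences c₀ c₁ c₂ u v w →
    OneMinusInverse t t⁻ → OneMinusInverse u u⁻ → OneMinusInverse v v⁻ → OneMinusInverse w w⁻ →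
    c₀ ≈ (1# + u + v) * v⁻ * w⁻ * c₁ + u * (1# - t) * t⁻ * u⁻ * v⁻ * w⁻ * c₂
  recurrence {c₀} {c₁} {c₂} {u} {v} {w} {t} {t⁻} {u⁻} {v⁻} {w⁻} eqs inv-t inv-u inv-v inv-w = begin
    c₀
      ≈⟨ *-identityˡ c₀ ⟨
    1# * c₀
      ≈⟨ *-congʳ {c₀} product-inverse ⟨
    u⁻ * v⁻ * w⁻ * ((1# - u) * (1# - v) * (1# - w)) * c₀
      ≈⟨ *-assoc (u⁻ * v⁻ * w⁻) ((1# - u) * (1# - v) * (1# - w)) c₀ ⟩
    u⁻ * v⁻ * w⁻ * ((1# - u) * (1# - v) * (1# - w) * c₀)
      ≈⟨ *-congˡ {u⁻ * v⁻ * w⁻} (cleared-recurrence eqs) ⟩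
    u⁻ * v⁻ * w⁻ * ((1# - u) * (1# + u + v) * c₁ + u * c₂)
      ≈⟨ solve 7 (λ u⁻ v⁻ w⁻ u v c₁ c₂ → u⁻ :* v⁻ :* w⁻ :* ((:1 :- u) :* (:1 :+ u :+ v) :* c₁ :+ u :* c₂)
                   := u⁻ :* (:1 :- u) :* ((:1 :+ u :+ v) :* v⁻ :* w⁻ :* c₁) :+ u :* u⁻ :* v⁻ :* w⁻ :* c₂)
                 refl u⁻ v⁻ w⁻ u v c₁ c₂ ⟩
    u⁻ * (1# - u) * ((1# + u + v) * v⁻ * w⁻ * c₁) + u * u⁻ * v⁻ * w⁻ * c₂
      ≈⟨ +-cong (*-congʳ {(1# + u + v) * v⁻ * w⁻ * c₁} (inverse inv-u))
                (sym (trans (*-congʳ {u * u⁻ * v⁻ * w⁻ * c₂} (inverse inv-t))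
                            (*-identityˡ (u * u⁻ * v⁻ * w⁻ * c₂)))) ⟩
    1# * ((1# + u + v) * v⁻ * w⁻ * c₁) + t⁻ * (1# - t) * (u * u⁻ * v⁻ * w⁻ * c₂)
      ≈⟨ solve 9 (λ t⁻ u⁻ v⁻ w⁻ t u v c₁ c₂ →
                     :1 :* ((:1 :+ u :+ v) :* v⁻ :* w⁻ :* c₁) :+ t⁻ :* (:1 :- t) :* (u :* u⁻ :* v⁻ :* w⁻ :* c₂)
                  := (:1 :+ u :+ v) :* v⁻ :* w⁻ :* c₁ :+ u :* (:1 :- t) :* t⁻ :* u⁻ :* v⁻ :* w⁻ :* c₂)
                 refl t⁻ u⁻ v⁻ w⁻ t u v c₁ c₂ ⟩
    (1# + u + v) * v⁻ * w⁻ * c₁ + u * (1# - t) * t⁻ * u⁻ * v⁻ * w⁻ * c₂ ∎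
    where
    product-inverse : u⁻ * v⁻ * w⁻ * ((1# - u) * (1# - v) * (1# - w)) ≈ 1#
    product-inverse = begin
      u⁻ * v⁻ * w⁻ * ((1# - u) * (1# - v) * (1# - w))
        ≈⟨ solve 6 (λ u⁻ v⁻ w⁻ u v w → u⁻ :* v⁻ :* w⁻ :* ((:1 :- u) :* (:1 :- v) :* (:1 :- w))
                                    := u⁻ :* (:1 :- u) :* (v⁻ :* (:1 :- v)) :* (w⁻ :* (:1 :- w)))
                   refl u⁻ v⁻ w⁻ u v w ⟩
      u⁻ * (1# - u) * (v⁻ * (1# - v)) * (w⁻ * (1# - w))
        ≈⟨ *-cong (*-cong (inverse inv-u) (inverse inv-v)) (inverse inv-w) ⟩
      1# * 1# * 1#
        ≈⟨ trans (*-identityʳ (1# * 1#)) (*-identityʳ 1#) ⟩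
      1# ∎

  inv1mq-inverse : ∀ {e} → 0 < e → OneMinusInverse (qpow e) (inv1mq e)
  inv1mq-inverse {suc e} _ = record { inverse = begin
    I * (1# - qpow (suc e))                 ≈⟨ solve 2 (λ I x → I :* (:1 :- x) := I :- x :* I) refl I (qpow (suc e)) ⟩
    I - qpow (suc e) * I                    ≈⟨ +-congˡ {I} (-‿cong (qpow-⊛ (suc e) I)) ⟩
    I - shift (suc e) I                     ≈⟨ +-congʳ {(- shift (suc e) I)} (inv1mq-unfold e) ⟩
    1# + shift (suc e) I - shift (suc e) I  ≈⟨ solve 1 (λ s → :1 :+ s :- s := :1) refl (shift (suc e) I) ⟩
    1#                                      ∎ }
    where
    I : Carrier
    I = inv1mq (suc e)

module Counting where

  open import Data.Nat using (ℕ; suc; _+_)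
  import Data.Nat.Properties as ℕP
  open import Data.List using (List; []; _∷_; filter; length; map)
  import Data.List.Properties as LP
  open import Data.List.Membership.Propositional using (_∈_)
  open import Data.List.Membership.Propositional.Properties using (∈-filter⁺; ∈-filter⁻; ∈-map⁺; ∈-map⁻)
  open import Data.List.Membership.Propositional.Properties.WithK using (unique∧set⇒bag)
  open import Data.List.Relation.Binary.BagAndSetEquality using (∼bag⇒↭)
  open import Data.List.Relation.Binary.Permutation.Propositional.Properties using (↭-length)
  open import Data.List.Relation.Unary.Any using (here; there)
  open import Data.List.Relation.Unary.All using (tabulate)
  open import Data.List.Relation.Unary.Unique.Propositional using (Unique)
  import Data.List.Relation.Unary.Unique.Propositional.Properties as Unique
  open import Data.Product using (_×_; _,_; ∃-syntax)
  open import Function using (Injective; mk⇔; _∘′_)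
  open import Relation.Nullary using (yes; no; ¬_; contradiction)
  open import Relation.Unary using (Pred; Decidable)
  open import Relation.Unary.Properties using (_∩?_; ∁?)
  open import Relation.Binary.PropositionalEquality

  module _ {a} {A : Set a} where

    count : ∀ {p} {P : Pred A p} → Decidable P → List A → ℕ
    count P? xs = length (filter P? xs)

    count-none : ∀ {p} {P : Pred A p} (P? : Decidable P) {xs} → (∀ {x} → x ∈ xs → ¬ P x) → count P? xs ≡ 0
    count-none P? ¬P = cong length (LP.filter-none P? (tabulate ¬P))

    module _ {p q} {P : Pred A p} {Q : Pred A q} (P? : Decidable P) (Q? : Decidable Q) where

      count-cong : ∀ {xs} → (∀ {x} → x ∈ xs → P x → Q x) → (∀ {x} → x ∈ xs → Q x → P x) →
                   count P? xs ≡ count Q? xs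
      count-cong {[]}     _   _   = refl
      count-cong {x ∷ xs} P⇒Q Q⇒P with P? x | Q? x
      ... | yes _  | yes _  = cong suc (count-cong (P⇒Q ∘′ there) (Q⇒P ∘′ there))
      ... | no  _  | no  _  = count-cong (P⇒Q ∘′ there) (Q⇒P ∘′ there)
      ... | yes px | no ¬qx = contradiction (P⇒Q (here refl) px) ¬qx
      ... | no ¬px | yes qx = contradiction (Q⇒P (here refl) qx) ¬px

      count-split : ∀ xs → count P? xs ≡ count (P? ∩? Q?) xs + count (P? ∩? ∁? Q?) xs
      count-split []       = refl
      count-split (x ∷ xs) with P? x | Q? x
      ... | yes _ | yes _ = cong suc (count-split xs)
      ... | yes _ | no  _ = trans (cong suc (count-split xs)) (sym (ℕP.+-suc _ _))
      ... | no  _ | _     = count-split xs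

  module _ {a b p q} {A : Set a} {B : Set b} {P : Pred A p} {Q : Pred B q}
           (P? : Decidable P) (Q? : Decidable Q) where

    count-bij : ∀ {xs ys} (f : A → B) → Injective _≡_ _≡_ f → Unique xs → Unique ys →
                (∀ {x} → x ∈ xs → P x → f x ∈ ys × Q (f x)) →
                (∀ {y} → y ∈ ys → Q y → ∃[ x ] x ∈ xs × P x × f x ≡ y) →
                count P? xs ≡ count Q? ys
    count-bij {xs} {ys} f f-injective xs! ys! into onto = begin
      count P? xs                    ≡⟨ LP.length-map f (filter P? xs) ⟨
      length (map f (filter P? xs))  ≡⟨ ↭-length (∼bag⇒↭ (unique∧set⇒bag image! (Unique.filter⁺ Q? ys!)
                                                                    (mk⇔ to from))) ⟩
      count Q? ys                    ∎
      where
      open ≡-Reasoning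
      image! : Unique (map f (filter P? xs))
      image! = Unique.map⁺ f-injective (Unique.filter⁺ P? xs!)
      to : ∀ {y} → y ∈ map f (filter P? xs) → y ∈ filter Q? ys
      to y∈ with _ , x∈ , refl ← ∈-map⁻ f y∈
              with x∈xs , px ← ∈-filter⁻ P? x∈
              with fx∈ys , qfx ← into x∈xs px
        = ∈-filter⁺ Q? fx∈ys qfx
      from : ∀ {y} → y ∈ filter Q? ys → y ∈ map f (filter P? xs)
      from y∈ with y∈ys , qy ← ∈-filter⁻ Q? y∈
                with x , x∈xs , px , refl ← onto y∈ys qy
        = ∈-map⁺ f (∈-filter⁺ P? x∈xs px)
module CylindricPairs where

  open import Data.Nat using (ℕ; zero; suc; _+_; _≤_; _<_; _≤′_; ≤′-refl; ≤′-step; z≤n; s≤s; pred; _≤?_; _<?_)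
  import Data.Nat.Properties as ℕP
  open import Algebra.Properties.CommutativeSemigroup ℕP.+-commutativeSemigroup using (x∙yz≈y∙xz; interchange)
  open import Data.List
    using (List; []; _∷_; _∷ʳ_; _++_; length; map; upTo; take; cartesianProduct; cartesianProductWith; concatMap)
  import Data.List.Properties as LP
  open import Data.List.Membership.Propositional using (_∈_)
  open import Data.List.Membership.Propositional.Properties
    using (∈-cartesianProductWith⁺; ∈-cartesianProductWith⁻; ∈-cartesianProduct⁺; ∈-cartesianProduct⁻; ∈-upTo⁺)
  open import Data.List.Relation.Unary.Any using (here)
  open import Data.List.Relation.Unary.All as All using (All; []; _∷_)
  import Data.List.Relation.Unary.All.Properties as Allₚ
  open import Data.List.Relation.Unary.AllPairs using ([]; _∷_)
  open import Data.List.Relation.Unary.Unique.Propositional using (Unique)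
  import Data.List.Relation.Unary.Unique.Propositional.Properties as Unique
  open import Data.Product using (_×_; _,_; proj₁; proj₂)
  open import Data.Unit using (⊤; tt)
  open import Function using (_∘_; id; Injective)
  open import Relation.Nullary using (yes; no; ¬_; contradiction)
  open import Relation.Unary using (Decidable)
  open import Relation.Binary.PropositionalEquality

  nth-beyond : ∀ l {i} → length l ≤ i → nth l i ≡ 0
  nth-beyond []      _         = refl
  nth-beyond (x ∷ l) (s≤s l≤i) = nth-beyond l l≤i

  nth-beyond-≤ : ∀ l {i x} → length l ≤ i → nth l i ≤ x
  nth-beyond-≤ l l≤i = subst (_≤ _) (sym (nth-beyond l l≤i)) z≤n

  parts≤size : ∀ l → All (_≤ size l) l
  parts≤size []      = []
  parts≤size (x ∷ l) =
    ℕP.m≤m+n x (size l) ∷ All.map (λ p → ℕP.≤-trans p (ℕP.m≤n+m (size l) x)) (parts≤size l)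

  Decreasing : List ℕ → Set
  Decreasing l = ∀ i → nth l (suc i) ≤ nth l i

  decreasing-≤ : ∀ {l} → Decreasing l → ∀ {i j} → i ≤ j → nth l j ≤ nth l i
  decreasing-≤ {l} d i≤j = go (ℕP.≤⇒≤′ i≤j)
    where
    go : ∀ {i j} → i ≤′ j → nth l j ≤ nth l i
    go ≤′-refl        = ℕP.≤-refl
    go (≤′-step i≤′j) = ℕP.≤-trans (d _) (go i≤′j)

  decreasing-zero : ∀ {l} → Decreasing l → ∀ {i j} → nth l i ≡ 0 → i ≤ j → nth l j ≡ 0
  decreasing-zero {l} d lᵢ≡0 i≤j = ℕP.n≤0⇒n≡0 (subst (_ ≤_) lᵢ≡0 (decreasing-≤ {l} d i≤j))

  -- For a partition l: at most m, resp. at least m, nonzero parts.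
  AtMost : ℕ → List ℕ → Set
  AtMost m l = nth l m ≡ 0

  AtLeast : ℕ → List ℕ → Set
  AtLeast zero    l = ⊤
  AtLeast (suc m) l = 1 ≤ nth l m

  atMost? : ∀ m → Decidable (AtMost m)
  atMost? m l = nth l m ℕP.≟ 0

  atLeast? : ∀ m → Decidable (AtLeast m)
  atLeast? zero    l = yes tt
  atLeast? (suc m) l = 1 ≤? nth l m

  atMost-suc : ∀ {m l} → Decreasing l → AtMost m l → AtMost (suc m) l
  atMost-suc {l = l} d z = decreasing-zero {l} d z (ℕP.n≤1+n _)

  atMost⇒¬atLeast : ∀ {m l} → AtMost m l → ¬ AtLeast (suc m) l
  atMost⇒¬atLeast z p = ℕP.<⇒≢ p (sym z)

  ¬atLeast⇒atMost : ∀ {m l} → ¬ AtLeast (suc m) l → AtMost m l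
  ¬atLeast⇒atMost ¬p = ℕP.n<1⇒n≡0 (ℕP.≰⇒> ¬p)

  atLeast⇒positive : ∀ {m l} → Decreasing l → AtLeast m l → ∀ {i} → i < m → 1 ≤ nth l i
  atLeast⇒positive {suc m} {l} d p (s≤s i≤m) = ℕP.≤-trans p (decreasing-≤ {l} d i≤m)

  vecs-suc : ∀ n k → vecs (suc n) k ≡ cartesianProductWith _∷_ (upTo (suc k)) (vecs n k)
  vecs-suc n k = go (upTo (suc k))
    where
    go : ∀ xs → concatMap (λ x → map (x ∷_) (vecs n k)) xs ≡ cartesianProductWith _∷_ xs (vecs n k)
    go []       = refl
    go (x ∷ xs) = cong (map (x ∷_) (vecs n k) ++_) (go xs)

  vecs-unique : ∀ n k → Unique (vecs n k)
  vecs-unique zero    k = [] ∷ []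
  vecs-unique (suc n) k rewrite vecs-suc n k =
    Unique.cartesianProductWith⁺ _∷_ LP.∷-injective (Unique.upTo⁺ (suc k)) (vecs-unique n k)

  ∈-vecs⁻ : ∀ n k {l} → l ∈ vecs n k → length l ≡ n
  ∈-vecs⁻ zero    k (here refl) = refl
  ∈-vecs⁻ (suc n) k l∈ rewrite vecs-suc n k
    with _ , _ , _ , l′∈ , refl ← ∈-cartesianProductWith⁻ _∷_ (upTo (suc k)) (vecs n k) l∈
    = cong suc (∈-vecs⁻ n k l′∈)

  ∈-vecs⁺ : ∀ n k {l} → length l ≡ n → All (_≤ k) l → l ∈ vecs n k
  ∈-vecs⁺ zero    k {[]}    refl []         = here refl
  ∈-vecs⁺ (suc n) k {x ∷ l} len  (x≤k ∷ l≤k) rewrite vecs-suc n k =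
    ∈-cartesianProductWith⁺ _∷_ (∈-upTo⁺ (s≤s x≤k)) (∈-vecs⁺ n k (ℕP.suc-injective len) l≤k)

  pairs : ℕ → ℕ → List (List ℕ × List ℕ)
  pairs N k = cartesianProduct (vecs N k) (vecs N k)

  pairs-unique : ∀ N k → Unique (pairs N k)
  pairs-unique N k = Unique.cartesianProduct⁺ (vecs-unique N k) (vecs-unique N k)

  -- IsCP22 with its conditions required at every index rather than below N.
  record Cylindric (N k : ℕ) (a b : List ℕ) : Set where
    field
      length₁     : length a ≡ N
      length₂     : length b ≡ N
      decreasing₁ : Decreasing a
      decreasing₂ : Decreasing b
      interlace₁  : ∀ i → nth b (i + 2) ≤ nth a i
      interlace₂  : ∀ i → nth a (i + 2) ≤ nth b i
      size≡       : size a + size b ≡ k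
  open Cylindric public

  toCylindric : ∀ {N k a b} → (a , b) ∈ pairs N k → IsCP22 N k (a , b) → Cylindric N k a b
  toCylindric {N} {k} {a} {b} ab∈ (dec₁ , dec₂ , (int₁ , int₂) , size≡) = record
    { length₁     = len₁
    ; length₂     = len₂
    ; decreasing₁ = everywhere dec₁ λ N≤i → vanishing a len₁ (ℕP.m≤n⇒m≤1+n N≤i)
    ; decreasing₂ = everywhere dec₂ λ N≤i → vanishing b len₂ (ℕP.m≤n⇒m≤1+n N≤i)
    ; interlace₁  = everywhere int₁ λ N≤i → vanishing b len₂ (ℕP.≤-trans N≤i (ℕP.m≤m+n _ 2))
    ; interlace₂  = everywhere int₂ λ N≤i → vanishing a len₁ (ℕP.≤-trans N≤i (ℕP.m≤m+n _ 2))
    ; size≡       = size≡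
    }
    where
    len₁ = ∈-vecs⁻ N k (proj₁ (∈-cartesianProduct⁻ (vecs N k) (vecs N k) ab∈))
    len₂ = ∈-vecs⁻ N k (proj₂ (∈-cartesianProduct⁻ (vecs N k) (vecs N k) ab∈))
    vanishing : ∀ l {i x} → length l ≡ N → N ≤ i → nth l i ≤ x
    vanishing l len N≤i = nth-beyond-≤ l (subst (_≤ _) (sym len) N≤i)
    everywhere : ∀ {P : ℕ → Set} → All P (upTo N) → (∀ {i} → N ≤ i → P i) → ∀ i → P i
    everywhere below beyond i with i <? N
    ... | yes i<N = Allₚ.applyUpTo⁻ id N below i<N
    ... | no  i≮N = beyond (ℕP.≮⇒≥ i≮N)

  fromCylindric : ∀ {N k a b} → Cylindric N k a b → (a , b) ∈ pairs N k × IsCP22 N k (a , b)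
  fromCylindric {N} {k} {a} {b} c =
    ∈-cartesianProduct⁺ (∈-vecs⁺ N k (length₁ c) (bounded a (ℕP.m≤m+n (size a) (size b))))
                        (∈-vecs⁺ N k (length₂ c) (bounded b (ℕP.m≤n+m (size b) (size a))))
    , below (decreasing₁ c) , below (decreasing₂ c) , (below (interlace₁ c) , below (interlace₂ c)) , size≡ c
    where
    bounded : ∀ l → size l ≤ size a + size b → All (_≤ k) l
    bounded l l≤ = All.map (λ p → ℕP.≤-trans p (ℕP.≤-trans l≤ (ℕP.≤-reflexive (size≡ c)))) (parts≤size l)
    below : ∀ {P : ℕ → Set} → (∀ i → P i) → All P (upTo N)
    below p = Allₚ.applyUpTo⁺₁ id N (λ {i} _ → p i)

  Cylindric-swap : ∀ {N k a b} → Cylindric N k a b → Cylindric N k b a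
  Cylindric-swap {a = a} {b} c = record
    { length₁     = length₂ c
    ; length₂     = length₁ c
    ; decreasing₁ = decreasing₂ c
    ; decreasing₂ = decreasing₁ c
    ; interlace₁  = interlace₂ c
    ; interlace₂  = interlace₁ c
    ; size≡       = trans (ℕP.+-comm (size b) (size a)) (size≡ c)
    }

  Cylindric-map : ∀ {N k a b N′ k′ a′ b′} (φ : ℕ → ℕ) → (∀ {x y} → x ≤ y → φ x ≤ φ y) →
                  (∀ i → nth a′ i ≡ φ (nth a i)) → (∀ i → nth b′ i ≡ φ (nth b i)) →
                  length a′ ≡ N′ → length b′ ≡ N′ → size a′ + size b′ ≡ k′ →
                  Cylindric N k a b → Cylindric N′ k′ a′ b′
  Cylindric-map {a = a} {b} {a′ = a′} {b′} φ φ-mono a′≡ b′≡ len₁ len₂ size≡′ c = record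
    { length₁     = len₁
    ; length₂     = len₂
    ; decreasing₁ = λ i → lift {a} {a′} {a} {a′} a′≡ a′≡ (decreasing₁ c i)
    ; decreasing₂ = λ i → lift {b} {b′} {b} {b′} b′≡ b′≡ (decreasing₂ c i)
    ; interlace₁  = λ i → lift {b} {b′} {a} {a′} b′≡ a′≡ (interlace₁ c i)
    ; interlace₂  = λ i → lift {a} {a′} {b} {b′} a′≡ b′≡ (interlace₂ c i)
    ; size≡       = size≡′
    }
    where
    lift : ∀ {u u′ v v′ i j} → (∀ i → nth u′ i ≡ φ (nth u i)) → (∀ i → nth v′ i ≡ φ (nth v i)) →
           nth u i ≤ nth v j → nth u′ i ≤ nth v′ j
    lift {i = i} {j} u′≡ v′≡ p = subst₂ _≤_ (sym (u′≡ i)) (sym (v′≡ j)) (φ-mono p)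

  incr : ℕ → List ℕ → List ℕ
  incr zero    l       = l
  incr (suc m) []      = []
  incr (suc m) (x ∷ l) = suc x ∷ incr m l

  incr-injective : ∀ m → Injective _≡_ _≡_ (incr m)
  incr-injective zero    eq = eq
  incr-injective (suc m) {[]}    {[]}     _  = refl
  incr-injective (suc m) {x ∷ l} {y ∷ l′} eq =
    cong₂ _∷_ (ℕP.suc-injective (LP.∷-injectiveˡ eq)) (incr-injective m (LP.∷-injectiveʳ eq))

  length-incr : ∀ m l → length (incr m l) ≡ length l
  length-incr zero    l       = refl
  length-incr (suc m) []      = refl
  length-incr (suc m) (x ∷ l) = cong suc (length-incr m l)

  size-incr : ∀ m l → m ≤ length l → size (incr m l) ≡ m + size l
  size-incr zero    l       _         = refl
  size-incr (suc m) (x ∷ l) (s≤s m≤l) =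
    cong suc (trans (cong (x +_) (size-incr m l m≤l)) (x∙yz≈y∙xz x m (size l)))

  nth-incr-< : ∀ {m l i} → i < m → i < length l → nth (incr m l) i ≡ suc (nth l i)
  nth-incr-< {suc m} {x ∷ l} {zero}  _         _         = refl
  nth-incr-< {suc m} {x ∷ l} {suc i} (s≤s i<m) (s≤s i<l) = nth-incr-< i<m i<l

  nth-incr-≥ : ∀ {m l i} → m ≤ i → nth (incr m l) i ≡ nth l i
  nth-incr-≥ {zero}                  _         = refl
  nth-incr-≥ {suc m} {[]}            _         = refl
  nth-incr-≥ {suc m} {x ∷ l} {suc i} (s≤s m≤i) = nth-incr-≥ {m} {l} m≤i

  nth-incr-≤ : ∀ m l i → nth (incr m l) i ≤ suc (nth l i)
  nth-incr-≤ zero    l       i       = ℕP.n≤1+n _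
  nth-incr-≤ (suc m) []      i       = z≤n
  nth-incr-≤ (suc m) (x ∷ l) zero    = ℕP.≤-refl
  nth-incr-≤ (suc m) (x ∷ l) (suc i) = nth-incr-≤ m l i

  atLeast-incr : ∀ m l → m ≤ length l → AtLeast m (incr m l)
  atLeast-incr zero    l _   = tt
  atLeast-incr (suc m) l m<l = subst (1 ≤_) (sym (nth-incr-< {suc m} {l} (ℕP.n<1+n m) m<l)) (s≤s z≤n)

  incr-mono : ∀ {m m′ l l′ i j} → m ≤ length l → (m ≤ i → m′ ≤ j) →
              nth l′ j ≤ nth l i → nth (incr m′ l′) j ≤ nth (incr m l) i
  incr-mono {m} {m′} {l} {l′} {i} {j} m≤l m≤i⇒m′≤j l′ⱼ≤lᵢ with i <? m
  ... | yes i<m = subst (_ ≤_) (sym (nth-incr-< i<m (ℕP.<-≤-trans i<m m≤l)))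
                        (ℕP.≤-trans (nth-incr-≤ m′ l′ j) (s≤s l′ⱼ≤lᵢ))
  ... | no  i≮m = subst₂ _≤_ (sym (nth-incr-≥ {m′} {l′} (m≤i⇒m′≤j (ℕP.≮⇒≥ i≮m))))
                            (sym (nth-incr-≥ {m} {l} (ℕP.≮⇒≥ i≮m))) l′ⱼ≤lᵢ

  Cylindric-incr : ∀ {N k a b α β} → α ≤ N → β ≤ N → β ≤ α + 2 → α ≤ β + 2 →
                   Cylindric N k a b → Cylindric N (α + β + k) (incr α a) (incr β b)
  Cylindric-incr {N} {k} {a} {b} {α} {β} α≤N β≤N β≤α+2 α≤β+2 c = record
    { length₁     = trans (length-incr α a) (length₁ c)
    ; length₂     = trans (length-incr β b) (length₂ c)
    ; decreasing₁ = λ i → incr-mono {α} {α} {a} {a} α≤a ℕP.m≤n⇒m≤1+n (decreasing₁ c i)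
    ; decreasing₂ = λ i → incr-mono {β} {β} {b} {b} β≤b ℕP.m≤n⇒m≤1+n (decreasing₂ c i)
    ; interlace₁  = λ i → incr-mono {α} {β} {a} {b} α≤a (λ α≤i → ℕP.≤-trans β≤α+2 (ℕP.+-monoˡ-≤ 2 α≤i))
                                    (interlace₁ c i)
    ; interlace₂  = λ i → incr-mono {β} {α} {b} {a} β≤b (λ β≤i → ℕP.≤-trans α≤β+2 (ℕP.+-monoˡ-≤ 2 β≤i))
                                    (interlace₂ c i)
    ; size≡       = begin
        size (incr α a) + size (incr β b)   ≡⟨ cong₂ _+_ (size-incr α a α≤a) (size-incr β b β≤b) ⟩
        (α + size a) + (β + size b)         ≡⟨ interchange α (size a) β (size b) ⟩
        α + β + (size a + size b)           ≡⟨ cong (α + β +_) (size≡ c) ⟩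
        α + β + k                           ∎
    }
    where
    open ≡-Reasoning
    α≤a = subst (α ≤_) (sym (length₁ c)) α≤N
    β≤b = subst (β ≤_) (sym (length₂ c)) β≤N

  nth-map-pred : ∀ l i → nth (map pred l) i ≡ pred (nth l i)
  nth-map-pred []      i       = refl
  nth-map-pred (x ∷ l) zero    = refl
  nth-map-pred (x ∷ l) (suc i) = nth-map-pred l i

  incr-map-pred : ∀ m l → (∀ {i} → i < m → 1 ≤ nth l i) → (∀ {i} → m ≤ i → nth l i ≡ 0) →
                  incr m (map pred l) ≡ l
  incr-map-pred zero    []          _   _   = refl
  incr-map-pred zero    (zero ∷ l)  _   van = cong (0 ∷_) (incr-map-pred 0 l (λ ()) (λ {i} _ → van {suc i} z≤n))
  incr-map-pred zero    (suc x ∷ l) _   van = contradiction (van {0} z≤n) λ ()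
  incr-map-pred (suc m) []          _   _   = refl
  incr-map-pred (suc m) (zero ∷ l)  pos _   = contradiction (pos (s≤s z≤n)) λ ()
  incr-map-pred (suc m) (suc x ∷ l) pos van =
    cong (suc x ∷_) (incr-map-pred m l (pos ∘ s≤s) (van ∘ s≤s))

  size-map-pred : ∀ m l → (∀ {i} → i < m → 1 ≤ nth l i) → (∀ {i} → m ≤ i → nth l i ≡ 0) →
                  m + size (map pred l) ≡ size l
  size-map-pred zero    []          _   _   = refl
  size-map-pred zero    (zero ∷ l)  _   van = size-map-pred 0 l (λ ()) (λ {i} _ → van {suc i} z≤n)
  size-map-pred zero    (suc x ∷ l) _   van = contradiction (van {0} z≤n) λ ()
  size-map-pred (suc m) []          pos _   = contradiction (pos (s≤s z≤n)) λ ()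
  size-map-pred (suc m) (zero ∷ l)  pos _   = contradiction (pos (s≤s z≤n)) λ ()
  size-map-pred (suc m) (suc x ∷ l) pos van =
    cong suc (trans (x∙yz≈y∙xz m x _) (cong (x +_) (size-map-pred m l (pos ∘ s≤s) (van ∘ s≤s))))

  size-map-pred-pair : ∀ {N K a b α β} → Cylindric N K a b →
                       AtMost α a → AtMost β b → AtLeast α a → AtLeast β b →
                       α + β + (size (map pred a) + size (map pred b)) ≡ K
  size-map-pred-pair {K = K} {a} {b} {α} {β} c za zb pa pb = begin
    α + β + (size (map pred a) + size (map pred b))
      ≡⟨ interchange α (size (map pred a)) β (size (map pred b)) ⟨
    (α + size (map pred a)) + (β + size (map pred b))
      ≡⟨ cong₂ _+_ (size-map-pred α a (atLeast⇒positive {α} {a} (decreasing₁ c) pa)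
                                      (decreasing-zero {a} (decreasing₁ c) za))
                   (size-map-pred β b (atLeast⇒positive {β} {b} (decreasing₂ c) pb)
                                      (decreasing-zero {b} (decreasing₂ c) zb)) ⟩
    size a + size b
      ≡⟨ size≡ c ⟩
    K ∎
    where open ≡-Reasoning

  Cylindric-pred : ∀ {N k a b α β} → Cylindric N (α + β + k) a b →
                   AtMost α a → AtMost β b → AtLeast α a → AtLeast β b →
                   Cylindric N k (map pred a) (map pred b)
  Cylindric-pred {a = a} {b} {α} {β} c za zb pa pb =
    Cylindric-map pred ℕP.pred-mono-≤ (nth-map-pred a) (nth-map-pred b)
      (trans (LP.length-map pred a) (length₁ c)) (trans (LP.length-map pred b) (length₂ c))
      (ℕP.+-cancelˡ-≡ (α + β) _ _ (size-map-pred-pair c za zb pa pb)) c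

  nth-∷ʳ0 : ∀ l i → nth (l ∷ʳ 0) i ≡ nth l i
  nth-∷ʳ0 []      zero    = refl
  nth-∷ʳ0 []      (suc i) = refl
  nth-∷ʳ0 (x ∷ l) zero    = refl
  nth-∷ʳ0 (x ∷ l) (suc i) = nth-∷ʳ0 l i

  size-∷ʳ0 : ∀ l → size (l ∷ʳ 0) ≡ size l
  size-∷ʳ0 []      = refl
  size-∷ʳ0 (x ∷ l) = cong (x +_) (size-∷ʳ0 l)

  length-∷ʳ : ∀ l (x : ℕ) → length (l ∷ʳ x) ≡ suc (length l)
  length-∷ʳ []      x = refl
  length-∷ʳ (y ∷ l) x = cong suc (length-∷ʳ l x)

  take-∷ʳ0 : ∀ N l → length l ≡ suc N → AtMost N l → take N l ∷ʳ 0 ≡ l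
  take-∷ʳ0 zero    (x ∷ []) refl refl = refl
  take-∷ʳ0 (suc N) (x ∷ l)  len  z    = cong (x ∷_) (take-∷ʳ0 N l (ℕP.suc-injective len) z)

  Cylindric-∷ʳ0 : ∀ {N k a b} → Cylindric N k a b → Cylindric (suc N) k (a ∷ʳ 0) (b ∷ʳ 0)
  Cylindric-∷ʳ0 {a = a} {b} c =
    Cylindric-map id id (nth-∷ʳ0 a) (nth-∷ʳ0 b)
      (trans (length-∷ʳ a 0) (cong suc (length₁ c))) (trans (length-∷ʳ b 0) (cong suc (length₂ c)))
      (trans (cong₂ _+_ (size-∷ʳ0 a) (size-∷ʳ0 b)) (size≡ c)) c

  module _ {N} (l : List ℕ) (len : length l ≡ suc N) (z : AtMost N l) where

    nth-take : ∀ i → nth (take N l) i ≡ nth l i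
    nth-take i = trans (sym (nth-∷ʳ0 (take N l) i)) (cong (λ l′ → nth l′ i) (take-∷ʳ0 N l len z))

    length-take : length (take N l) ≡ N
    length-take = ℕP.suc-injective (trans (sym (length-∷ʳ (take N l) 0)) (trans (cong length (take-∷ʳ0 N l len z)) len))

    size-take : size (take N l) ≡ size l
    size-take = trans (sym (size-∷ʳ0 (take N l))) (cong size (take-∷ʳ0 N l len z))

  Cylindric-take : ∀ {N k a b} → Cylindric (suc N) k a b → AtMost N a → AtMost N b →
                   Cylindric N k (take N a) (take N b)
  Cylindric-take {a = a} {b} c za zb =
    Cylindric-map id id (nth-take a (length₁ c) za) (nth-take b (length₂ c) zb)
      (length-take a (length₁ c) za) (length-take b (length₂ c) zb)
      (trans (cong₂ _+_ (size-take a (length₁ c) za) (size-take b (length₂ c) zb)) (size≡ c)) c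

module RestrictedCounts where

  open Counting
  open CylindricPairs
  open PowerSeries using (_≈_; pointwise; at; ≈-refl; ≡⇒≈; ⊛-cong; ⊕-cong; qpow-⊛; shift; shift-<; shift-+; seriesRing)
  open RecurrenceAlgebra using (Recurrences)
  open import Level using (0ℓ)
  open import Data.Nat using (ℕ; zero; suc; _+_; _*_; _∸_; _≤_; _<_; pred; _<?_)
  import Data.Nat.Properties as ℕP
  open import Data.Integer using (+_)
  import Data.Integer.Properties as ℤP
  open import Data.List using (List; _∷ʳ_; map; take)
  import Data.List.Properties as LP
  open import Data.List.Membership.Propositional using (_∈_)
  open import Data.Product using (_×_; _,_; proj₁; proj₂; swap; ∃-syntax)
  open import Data.Unit using (tt)
  open import Function using (_∘_)
  open import Relation.Nullary using (yes; no; ¬_)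
  open import Relation.Nullary.Decidable using (_×-dec_)
  open import Relation.Unary using (Pred; Decidable; _∩_)
  open import Relation.Unary.Properties using (_∩?_; ∁?)
  open import Relation.Binary.PropositionalEquality
  open import Algebra.Bundles using (CommutativeRing)

  private
    module ℝ = CommutativeRing seriesRing

  Pair : Set
  Pair = List ℕ × List ℕ

  IsCP≤≤ : ℕ → ℕ → ℕ → ℕ → Pred Pair 0ℓ
  IsCP≤≤ N k α β (a , b) = IsCP22 N k (a , b) × AtMost α a × AtMost β b

  isCP≤≤? : ∀ N k α β → Decidable (IsCP≤≤ N k α β)
  isCP≤≤? N k α β (a , b) = isCP22? N k (a , b) ×-dec atMost? α a ×-dec atMost? β b

  IsCP≤≡ IsCP≡≡ : ℕ → ℕ → ℕ → ℕ → Pred Pair 0ℓ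
  IsCP≤≡ N k α β = IsCP≤≤ N k α β ∩ (AtLeast β ∘ proj₂)
  IsCP≡≡ N k α β = IsCP≤≡ N k α β ∩ (AtLeast α ∘ proj₁)

  isCP≤≡? : ∀ N k α β → Decidable (IsCP≤≡ N k α β)
  isCP≤≡? N k α β = isCP≤≤? N k α β ∩? (atLeast? β ∘ proj₂)

  isCP≡≡? : ∀ N k α β → Decidable (IsCP≡≡ N k α β)
  isCP≡≡? N k α β = isCP≤≡? N k α β ∩? (atLeast? α ∘ proj₁)

  #CP≤≤ #CP≤≡ #CP≡≡ : ℕ → ℕ → ℕ → ℕ → ℕ
  #CP≤≤ N k α β = count (isCP≤≤? N k α β) (pairs N k)
  #CP≤≡ N k α β = count (isCP≤≡? N k α β) (pairs N k)
  #CP≡≡ N k α β = count (isCP≡≡? N k α β) (pairs N k)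

  #CP22≡#CP≤≤ : ∀ N k → count (isCP22? N k) (pairs N k) ≡ #CP≤≤ N k N N
  #CP22≡#CP≤≤ N k = count-cong (isCP22? N k) (isCP≤≤? N k N N) bounded (λ _ → proj₁)
    where
    bounded : ∀ {x} → x ∈ pairs N k → IsCP22 N k x → IsCP≤≤ N k N N x
    bounded {a , b} ab∈ cp =
      cp , nth-beyond a (ℕP.≤-reflexive (length₁ c)) , nth-beyond b (ℕP.≤-reflexive (length₂ c))
      where c = toCylindric ab∈ cp

  module _ {N k : ℕ} where

    #CP≤≤-suc : ∀ α β → #CP≤≤ N k α (suc β) ≡ #CP≤≤ N k α β + #CP≤≡ N k α (suc β)
    #CP≤≤-suc α β = begin
      #CP≤≤ N k α (suc β)
        ≡⟨ count-split (isCP≤≤? N k α (suc β)) (atLeast? (suc β) ∘ proj₂) (pairs N k) ⟩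
      #CP≤≡ N k α (suc β) + count (isCP≤≤? N k α (suc β) ∩? ∁? (atLeast? (suc β) ∘ proj₂)) (pairs N k)
        ≡⟨ ℕP.+-comm (#CP≤≡ N k α (suc β)) _ ⟩
      count (isCP≤≤? N k α (suc β) ∩? ∁? (atLeast? (suc β) ∘ proj₂)) (pairs N k) + #CP≤≡ N k α (suc β)
        ≡⟨ cong (_+ #CP≤≡ N k α (suc β)) (count-cong _ (isCP≤≤? N k α β) to from) ⟩
      #CP≤≤ N k α β + #CP≤≡ N k α (suc β) ∎
      where
      open ≡-Reasoning
      to : ∀ {x} → x ∈ pairs N k → _ → IsCP≤≤ N k α β x
      to {a , b} _ ((cp , za , _) , ¬pb) = cp , za , ¬atLeast⇒atMost {β} {b} ¬pb
      from : ∀ {x} → x ∈ pairs N k → IsCP≤≤ N k α β x → _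
      from {a , b} ab∈ (cp , za , zb) =
        (cp , za , atMost-suc {β} {b} (decreasing₂ (toCylindric ab∈ cp)) zb) , atMost⇒¬atLeast {β} {b} zb

    #CP≤≡-suc : ∀ α β → #CP≤≡ N k (suc α) β ≡ #CP≡≡ N k (suc α) β + #CP≤≡ N k α β
    #CP≤≡-suc α β = begin
      #CP≤≡ N k (suc α) β
        ≡⟨ count-split (isCP≤≡? N k (suc α) β) (atLeast? (suc α) ∘ proj₁) (pairs N k) ⟩
      #CP≡≡ N k (suc α) β + count (isCP≤≡? N k (suc α) β ∩? ∁? (atLeast? (suc α) ∘ proj₁)) (pairs N k)
        ≡⟨ cong (_+_ (#CP≡≡ N k (suc α) β)) (count-cong _ (isCP≤≡? N k α β) to from) ⟩
      #CP≡≡ N k (suc α) β + #CP≤≡ N k α β ∎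
      where
      open ≡-Reasoning
      to : ∀ {x} → x ∈ pairs N k → _ → IsCP≤≡ N k α β x
      to {a , b} _ (((cp , _ , zb) , pb) , ¬pa) = (cp , ¬atLeast⇒atMost {α} {a} ¬pa , zb) , pb
      from : ∀ {x} → x ∈ pairs N k → IsCP≤≡ N k α β x → _
      from {a , b} ab∈ ((cp , za , zb) , pb) =
        ((cp , atMost-suc {α} {a} (decreasing₁ (toCylindric ab∈ cp)) za , zb) , pb) , atMost⇒¬atLeast {α} {a} za

    #CP≤≡-gap : ∀ α → #CP≤≡ N k α (2 + α) ≡ #CP≡≡ N k α (2 + α)
    #CP≤≡-gap α = count-cong (isCP≤≡? N k α (2 + α)) (isCP≡≡? N k α (2 + α)) to (λ _ → proj₁)
      where
      to : ∀ {x} → x ∈ pairs N k → IsCP≤≡ N k α (2 + α) x → IsCP≡≡ N k α (2 + α) x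
      to {a , b} ab∈ p@((cp , _) , pb) = p , forced α refl
        where
        forced : ∀ α′ → α′ ≡ α → AtLeast α′ a
        forced zero     _    = tt
        forced (suc α′) refl =
          ℕP.≤-trans pb (subst (λ j → nth b j ≤ nth a α′) (ℕP.+-comm α′ 2)
                               (interlace₁ (toCylindric ab∈ cp) α′))

    #CP≤≤-sym : ∀ α β → #CP≤≤ N k α β ≡ #CP≤≤ N k β α
    #CP≤≤-sym α β =
      count-bij (isCP≤≤? N k α β) (isCP≤≤? N k β α) swap (cong swap) (pairs-unique N k) (pairs-unique N k)
        (swap-into α β) (λ {y} y∈ p → swap y , swap-into β α y∈ p .proj₁ , swap-into β α y∈ p .proj₂ , refl)
      where
      swap-into : ∀ α β {x} → x ∈ pairs N k → IsCP≤≤ N k α β x →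
                  swap x ∈ pairs N k × IsCP≤≤ N k β α (swap x)
      swap-into α β {a , b} ab∈ (cp , za , zb) =
        let ba∈ , cp′ = fromCylindric (Cylindric-swap (toCylindric ab∈ cp)) in ba∈ , cp′ , zb , za

    #CP≡≡-small : ∀ {α β} → k < α + β → #CP≡≡ N k α β ≡ 0
    #CP≡≡-small {α} {β} k<α+β = count-none (isCP≡≡? N k α β) small
      where
      small : ∀ {x} → x ∈ pairs N k → ¬ IsCP≡≡ N k α β x
      small {a , b} ab∈ (((cp , za , zb) , pb) , pa) =
        ℕP.<⇒≱ k<α+β (subst (α + β ≤_) (size-map-pred-pair (toCylindric ab∈ cp) za zb pa pb) (ℕP.m≤m+n (α + β) _))

  #CP≡≡-shift : ∀ {N α β} k → α ≤ N → β ≤ N → β ≤ α + 2 → α ≤ β + 2 →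
                #CP≡≡ N (α + β + k) α β ≡ #CP≤≤ N k α β
  #CP≡≡-shift {N} {α} {β} k α≤N β≤N β≤α+2 α≤β+2 = sym
    (count-bij (isCP≤≤? N k α β) (isCP≡≡? N K α β) raise raise-injective (pairs-unique N k) (pairs-unique N K)
               into onto)
    where
    K = α + β + k
    raise : Pair → Pair
    raise x = incr α (proj₁ x) , incr β (proj₂ x)
    raise-injective : ∀ {x y} → raise x ≡ raise y → x ≡ y
    raise-injective eq = cong₂ _,_ (incr-injective α (cong proj₁ eq)) (incr-injective β (cong proj₂ eq))
    into : ∀ {x} → x ∈ pairs N k → IsCP≤≤ N k α β x → raise x ∈ pairs N K × IsCP≡≡ N K α β (raise x)
    into {a , b} ab∈ (cp , za , zb) =
      ∈K , ((cp′ , trans (nth-incr-≥ {α} {a} ℕP.≤-refl) za , trans (nth-incr-≥ {β} {b} ℕP.≤-refl) zb)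
           , atLeast-incr β b (subst (β ≤_) (sym (length₂ c)) β≤N))
           , atLeast-incr α a (subst (α ≤_) (sym (length₁ c)) α≤N)
      where
      c = toCylindric ab∈ cp
      ∈K×cp′ = fromCylindric (Cylindric-incr α≤N β≤N β≤α+2 α≤β+2 c)
      ∈K  = proj₁ ∈K×cp′
      cp′ = proj₂ ∈K×cp′
    onto : ∀ {y} → y ∈ pairs N K → IsCP≡≡ N K α β y →
           ∃[ x ] x ∈ pairs N k × IsCP≤≤ N k α β x × raise x ≡ y
    onto {a , b} ab∈ (((cp , za , zb) , pb) , pa) =
      (map pred a , map pred b) , ∈k
      , (cp′ , trans (nth-map-pred a α) (cong pred za) , trans (nth-map-pred b β) (cong pred zb))
      , cong₂ _,_ (incr-map-pred α a (atLeast⇒positive {α} {a} (decreasing₁ c) pa) (decreasing-zero {a} (decreasing₁ c) za))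
                  (incr-map-pred β b (atLeast⇒positive {β} {b} (decreasing₂ c) pb) (decreasing-zero {b} (decreasing₂ c) zb))
      where
      c = toCylindric ab∈ cp
      ∈k×cp′ = fromCylindric (Cylindric-pred c za zb pa pb)
      ∈k  = proj₁ ∈k×cp′
      cp′ = proj₂ ∈k×cp′

  #CP≤≤-trunc : ∀ {N α β} k → α ≤ N → β ≤ N → #CP≤≤ (suc N) k α β ≡ #CP≤≤ N k α β
  #CP≤≤-trunc {N} {α} {β} k α≤N β≤N = sym
    (count-bij (isCP≤≤? N k α β) (isCP≤≤? (suc N) k α β) pad pad-injective (pairs-unique N k) (pairs-unique (suc N) k)
               into onto)
    where
    pad : Pair → Pair
    pad x = proj₁ x ∷ʳ 0 , proj₂ x ∷ʳ 0
    pad-injective : ∀ {x y} → pad x ≡ pad y → x ≡ y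
    pad-injective eq = cong₂ _,_ (LP.∷ʳ-injectiveˡ _ _ (cong proj₁ eq)) (LP.∷ʳ-injectiveˡ _ _ (cong proj₂ eq))
    into : ∀ {x} → x ∈ pairs N k → IsCP≤≤ N k α β x → pad x ∈ pairs (suc N) k × IsCP≤≤ (suc N) k α β (pad x)
    into {a , b} ab∈ (cp , za , zb) =
      let ∈′ , cp′ = fromCylindric (Cylindric-∷ʳ0 (toCylindric ab∈ cp))
      in  ∈′ , cp′ , trans (nth-∷ʳ0 a α) za , trans (nth-∷ʳ0 b β) zb
    onto : ∀ {y} → y ∈ pairs (suc N) k → IsCP≤≤ (suc N) k α β y →
           ∃[ x ] x ∈ pairs N k × IsCP≤≤ N k α β x × pad x ≡ y
    onto {a , b} ab∈ (cp , za , zb) =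
      (take N a , take N b) , ∈′
      , (cp′ , trans (nth-take a (length₁ c) zaN α) za , trans (nth-take b (length₂ c) zbN β) zb)
      , cong₂ _,_ (take-∷ʳ0 N a (length₁ c) zaN) (take-∷ʳ0 N b (length₂ c) zbN)
      where
      c   = toCylindric ab∈ cp
      zaN = decreasing-zero {a} (decreasing₁ c) za α≤N
      zbN = decreasing-zero {b} (decreasing₂ c) zb β≤N
      ∈×cp′ = fromCylindric (Cylindric-take c zaN zbN)
      ∈′  = proj₁ ∈×cp′
      cp′ = proj₂ ∈×cp′

  CP≤≤ CP≤≡ CP≡≡ : ℕ → ℕ → ℕ → Series
  CP≤≤ N α β k = + #CP≤≤ N k α β
  CP≤≡ N α β k = + #CP≤≡ N k α β
  CP≡≡ N α β k = + #CP≡≡ N k α β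

  CP22≈CP≤≤ : ∀ N → CP22 N ≈ CP≤≤ N N N
  CP22≈CP≤≤ N = pointwise λ k → cong +_ (#CP22≡#CP≤≤ N k)

  CP≤≤-trunc : ∀ N α β → α ≤ N → β ≤ N → CP≤≤ (suc N) α β ≈ CP≤≤ N α β
  CP≤≤-trunc N α β α≤N β≤N = pointwise λ k → cong +_ (#CP≤≤-trunc k α≤N β≤N)

  module _ (N : ℕ) where

    CP≤≤-suc : ∀ α β → CP≤≤ N α (suc β) ≈ CP≤≤ N α β ⊕ CP≤≡ N α (suc β)
    CP≤≤-suc α β = pointwise λ k →
      trans (cong +_ (#CP≤≤-suc {N} {k} α β)) (ℤP.pos-+ (#CP≤≤ N k α β) (#CP≤≡ N k α (suc β)))

    CP≤≡-suc : ∀ α β → CP≤≡ N (suc α) β ≈ CP≡≡ N (suc α) β ⊕ CP≤≡ N α β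
    CP≤≡-suc α β = pointwise λ k →
      trans (cong +_ (#CP≤≡-suc {N} {k} α β)) (ℤP.pos-+ (#CP≡≡ N k (suc α) β) (#CP≤≡ N k α β))

    CP≤≡-gap : ∀ α → CP≤≡ N α (2 + α) ≈ CP≡≡ N α (2 + α)
    CP≤≡-gap α = pointwise λ k → cong +_ (#CP≤≡-gap {N} {k} α)

    CP≤≤-sym : ∀ α β → CP≤≤ N α β ≈ CP≤≤ N β α
    CP≤≤-sym α β = pointwise λ k → cong +_ (#CP≤≤-sym {N} {k} α β)

    CP≡≡-shift : ∀ α β → α ≤ N → β ≤ N → β ≤ α + 2 → α ≤ β + 2 →
                 CP≡≡ N α β ≈ qpow (α + β) ⊛ CP≤≤ N α β
    CP≡≡-shift α β α≤N β≤N β≤α+2 α≤β+2 = pointwise λ k →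
      sym (trans (at (qpow-⊛ (α + β) (CP≤≤ N α β)) k) (coeff k))
      where
      coeff : ∀ k → shift (α + β) (CP≤≤ N α β) k ≡ CP≡≡ N α β k
      coeff k with k <? α + β
      ... | yes k<α+β = trans (shift-< (CP≤≤ N α β) k<α+β) (cong +_ (sym (#CP≡≡-small {N} {k} {α} {β} k<α+β)))
      ... | no  k≮α+β with j , refl ← ℕP.m≤n⇒∃[o]m+o≡n (ℕP.≮⇒≥ k≮α+β) =
        trans (shift-+ (α + β) (CP≤≤ N α β) j) (cong +_ (sym (#CP≡≡-shift j α≤N β≤N β≤α+2 α≤β+2)))

    CP≤≡-peel : ∀ α β → suc α ≤ N → β ≤ N → β ≤ suc α + 2 → suc α ≤ β + 2 →
                CP≤≡ N (suc α) β ≈ qpow (suc α + β) ⊛ CP≤≤ N (suc α) β ⊕ CP≤≡ N α β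
    CP≤≡-peel α β α<N β≤N β≤α+3 α<β+3 =
      ℝ.trans (CP≤≡-suc α β)
              (⊕-cong (CP≡≡-shift (suc α) β α<N β≤N β≤α+3 α<β+3) (≈-refl {CP≤≡ N α β}))

  module CP22-system (m : ℕ) where

    open import Relation.Binary.Reasoning.Setoid ℝ.setoid

    n : ℕ
    n = 2 + m

    x y z b u v w : Series
    x = CP≤≤ n (suc m) n
    y = CP≤≤ n m n
    z = CP≤≤ n (suc m) m
    b = CP≤≡ n m (suc m)
    u = qpow (2 * n ∸ 2)
    v = qpow (2 * n ∸ 1)
    w = qpow (2 * n)

    qpow-≡ : ∀ {e e′} → e ≡ e′ → qpow e ≈ qpow e′
    qpow-≡ e≡e′ = ≡⇒≈ (cong qpow e≡e′)

    2n≡n+n : 2 * n ≡ n + n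
    2n≡n+n = cong (_+_ n) (ℕP.+-identityʳ n)

    m<n : suc m ≤ n
    m<n = ℕP.n≤1+n (suc m)

    m≤n : m ≤ n
    m≤n = ℕP.≤-trans (ℕP.n≤1+n m) m<n

    c₁≈ : CP22 (suc m) ≈ CP≤≤ n (suc m) (suc m)
    c₁≈ = ℝ.trans (CP22≈CP≤≤ (suc m)) (ℝ.sym (CP≤≤-trunc (suc m) (suc m) (suc m) ℕP.≤-refl ℕP.≤-refl))

    c₂≈ : CP22 m ≈ CP≤≤ n m m
    c₂≈ = ℝ.trans (CP22≈CP≤≤ m) (ℝ.sym (ℝ.trans (CP≤≤-trunc (suc m) m m (ℕP.n≤1+n m) (ℕP.n≤1+n m))
                                                (CP≤≤-trunc m m m ℕP.≤-refl ℕP.≤-refl)))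

    exact-m : CP≤≡ n m n ≈ u ⊛ y
    exact-m = begin
      CP≤≡ n m n              ≈⟨ CP≤≡-gap n m ⟩
      CP≡≡ n m n              ≈⟨ CP≡≡-shift n m n m≤n ℕP.≤-refl (ℕP.≤-reflexive (ℕP.+-comm 2 m))
                                                     (ℕP.≤-trans m≤n (ℕP.m≤m+n n 2)) ⟩
      qpow (m + n) ⊛ y        ≈⟨ ⊛-cong (qpow-≡ (sym (cong (_∸ 2) 2n≡n+n))) (≈-refl {y}) ⟩
      u ⊛ y                   ∎

    exact-suc-m : CP≤≡ n (suc m) n ≈ v ⊛ x ⊕ u ⊛ y
    exact-suc-m = begin
      CP≤≡ n (suc m) n
        ≈⟨ CP≤≡-peel n m n m<n ℕP.≤-refl (ℕP.≤-trans (ℕP.n≤1+n n) (ℕP.≤-reflexive (ℕP.+-comm 2 (suc m))))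
                                         (ℕP.≤-trans m<n (ℕP.m≤m+n n 2)) ⟩
      qpow (suc m + n) ⊛ x ⊕ CP≤≡ n m n
        ≈⟨ ⊕-cong (⊛-cong (qpow-≡ (sym (cong (_∸ 1) 2n≡n+n))) (≈-refl {x})) exact-m ⟩
      v ⊛ x ⊕ u ⊛ y ∎

    eq₀ : CP22 n ≈ x ⊕ (w ⊛ CP22 n ⊕ (v ⊛ x ⊕ u ⊛ y))
    eq₀ = begin
      CP22 n
        ≈⟨ CP22≈CP≤≤ n ⟩
      CP≤≤ n n n
        ≈⟨ CP≤≤-suc n n (suc m) ⟩
      CP≤≤ n n (suc m) ⊕ CP≤≡ n n n
        ≈⟨ ⊕-cong (CP≤≤-sym n n (suc m))
                  (CP≤≡-peel n (suc m) n ℕP.≤-refl ℕP.≤-refl (ℕP.m≤m+n n 2) (ℕP.m≤m+n n 2)) ⟩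
      x ⊕ (qpow (n + n) ⊛ CP≤≤ n n n ⊕ CP≤≡ n (suc m) n)
        ≈⟨ ⊕-cong (≈-refl {x}) (⊕-cong (⊛-cong (qpow-≡ (sym 2n≡n+n)) (ℝ.sym (CP22≈CP≤≤ n))) exact-suc-m) ⟩
      x ⊕ (w ⊛ CP22 n ⊕ (v ⊛ x ⊕ u ⊛ y)) ∎

    eq₁ : x ≈ CP22 (suc m) ⊕ (v ⊛ x ⊕ u ⊛ y)
    eq₁ = begin
      x                                          ≈⟨ CP≤≤-suc n (suc m) (suc m) ⟩
      CP≤≤ n (suc m) (suc m) ⊕ CP≤≡ n (suc m) n  ≈⟨ ⊕-cong (ℝ.sym c₁≈) exact-suc-m ⟩
      CP22 (suc m) ⊕ (v ⊛ x ⊕ u ⊛ y)             ∎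

    eq₂ : y ≈ z ⊕ u ⊛ y
    eq₂ = begin
      y                              ≈⟨ CP≤≤-suc n m (suc m) ⟩
      CP≤≤ n m (suc m) ⊕ CP≤≡ n m n  ≈⟨ ⊕-cong (CP≤≤-sym n m (suc m)) exact-m ⟩
      z ⊕ u ⊛ y                      ∎

    eq₃ : CP22 (suc m) ≈ z ⊕ (u ⊛ CP22 (suc m) ⊕ b)
    eq₃ = begin
      CP22 (suc m)
        ≈⟨ c₁≈ ⟩
      CP≤≤ n (suc m) (suc m)
        ≈⟨ CP≤≤-suc n (suc m) m ⟩
      z ⊕ CP≤≡ n (suc m) (suc m)
        ≈⟨ ⊕-cong (≈-refl {z}) (CP≤≡-peel n m (suc m) m<n m<n (ℕP.m≤m+n (suc m) 2) (ℕP.m≤m+n (suc m) 2)) ⟩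
      z ⊕ (qpow (suc m + suc m) ⊛ CP≤≤ n (suc m) (suc m) ⊕ b)
        ≈⟨ ⊕-cong (≈-refl {z}) (⊕-cong (⊛-cong (qpow-≡ 2m+2≡2n∸2) (ℝ.sym c₁≈)) (≈-refl {b})) ⟩
      z ⊕ (u ⊛ CP22 (suc m) ⊕ b) ∎
      where
      2m+2≡2n∸2 : suc m + suc m ≡ 2 * n ∸ 2
      2m+2≡2n∸2 = trans (sym (ℕP.+-suc m (suc m))) (sym (cong (_∸ 2) 2n≡n+n))

    eq₄ : z ≈ CP22 m ⊕ b
    eq₄ = begin
      z                 ≈⟨ CP≤≤-sym n (suc m) m ⟩
      CP≤≤ n m (suc m)  ≈⟨ CP≤≤-suc n m m ⟩
      CP≤≤ n m m ⊕ b    ≈⟨ ⊕-cong (ℝ.sym c₂≈) (≈-refl {b}) ⟩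
      CP22 m ⊕ b        ∎

  cp-recurrences : ∀ m → let n = 2 + m in
    Recurrences (CP22 n) (CP22 (n ∸ 1)) (CP22 (n ∸ 2)) (qpow (2 * n ∸ 2)) (qpow (2 * n ∸ 1)) (qpow (2 * n))
  cp-recurrences m = record { CP22-system m }

open import Data.Nat using (ℕ; suc; z≤n; s≤s; _≤_; _≤?_; _*_; _∸_)
open import Relation.Binary.PropositionalEquality using (_≡_)
import Data.Nat.Properties as ℕP
open import Relation.Nullary.Decidable using (True; toWitness)
open PowerSeries using (at)
open RecurrenceAlgebra using (OneMinusInverse; recurrence; inv1mq-inverse)
open RestrictedCounts using (cp-recurrences)

theorem5p7 : (n : ℕ) → 2 ≤ n → (k : ℕ) →
    CP22 n k ≡
      ( (one ⊕ qpow (2 * n ∸ 2) ⊕ qpow (2 * n ∸ 1))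
          ⊛ inv1mq (2 * n ∸ 1) ⊛ inv1mq (2 * n)
          ⊛ CP22 (n ∸ 1)
      ⊕ (qpow (2 * n ∸ 2) ⊛ (one ⊖ qpow (2 * n ∸ 3)))
          ⊛ inv1mq (2 * n ∸ 3) ⊛ inv1mq (2 * n ∸ 2) ⊛ inv1mq (2 * n ∸ 1) ⊛ inv1mq (2 * n)
          ⊛ CP22 (n ∸ 2) ) k
theorem5p7 n@(suc (suc m)) 2≤n@(s≤s (s≤s z≤n)) =
  at (recurrence (cp-recurrences m) (geometric 3) (geometric 2) (geometric 1) (geometric 0))
  where
  geometric : ∀ i → {True (i ≤? 3)} → OneMinusInverse (qpow (2 * n ∸ i)) (inv1mq (2 * n ∸ i))
  geometric i {i≤3} = inv1mq-inverse (ℕP.m<n⇒0<n∸m (ℕP.<-≤-trans (s≤s (toWitness i≤3)) (ℕP.*-monoʳ-≤ 2 2≤n)))
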